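{- Let $q$ be an integer such that an affine plane of order $q$ exists and let $s$ be a positive integer. Then $C_1(sq^2,sq) \leq q^2+q$.
   Context: A $(v,k,\lambda)$-covering is a pair $(V,\mathcal{B})$ where $V$ is a set of $v$ points and $\mathcal{B}$ is a collection of $k$-subsets of $V$ (blocks) such that every pair of distinct points lies together in at least $\lambda$ blocks; $C_\lambda(v,k)$ is the minimum number of blocks in a $(v,k,\lambda)$-covering. An affine plane of order $q$ is a $(q^2,q,1)$-design: a set of $q^2$ points with a collection of $q$-subsets such that every pair of distinct points lies in exactly one block. -}

module Defs where

open import Data.Nat using (ℕ; zero; suc; _+_; _≤_)
open import Data.Bool using (Bool; true; false; _∧_; if_then_else_)
open import Data.Fin using (Fin)
open import Data.Fin.Subset using (Subset; ∣_∣)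
open import Data.Vec using (lookup)
open import Data.List using (List; []; _∷_; length)
open import Data.List.Relation.Unary.All using (All)
open import Data.Product using (Σ; _×_)
open import Relation.Binary.PropositionalEquality using (_≡_; _≢_)

-- Points are Fin v; a block is a subset of Fin v (Subset v = Vec Bool v).
-- A collection of blocks is a list (repetitions allowed).

countPair : {v : ℕ} → List (Subset v) → Fin v → Fin v → ℕ
countPair [] x y = 0
countPair (B ∷ Bs) x y =
  (if lookup B x ∧ lookup B y then 1 else 0) + countPair Bs x y

IsCovering : (v k λ' : ℕ) → List (Subset v) → Set
IsCovering v k λ' Bs =
  All (λ B → ∣ B ∣ ≡ k) Bs ×
  ((x y : Fin v) → x ≢ y → λ' ≤ countPair Bs x y)

-- C_λ(v,k) ≤ b : the minimum number of blocks of a (v,k,λ)-covering is at most b,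
-- i.e. some (v,k,λ)-covering has at most b blocks.
CoveringNumber≤ : (λ' v k b : ℕ) → Set
CoveringNumber≤ λ' v k b =
  Σ (List (Subset v)) (λ Bs → IsCovering v k λ' Bs × length Bs ≤ b)

IsDesign : (v k λ' : ℕ) → List (Subset v) → Set
IsDesign v k λ' Bs =
  All (λ B → ∣ B ∣ ≡ k) Bs ×
  ((x y : Fin v) → x ≢ y → countPair Bs x y ≡ λ')

-- an affine plane of order q exists: a (q², q, 1)-design exists
AffinePlaneExists : ℕ → Set
AffinePlaneExists q = Σ (List (Subset (q Data.Nat.* q))) (IsDesign (q Data.Nat.* q) q 1)

module Submission where

-- Construction: replace every point of the plane by s copies and every line by
-- the union of the copies of its points ("inflation").  Two copies of distinct
-- points are covered by the line through those points; two copies of the same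
-- point x are covered by the line through x and any other point.  So the
-- inflated lines form a (sq², sq, 1)-covering with as many blocks as the plane
-- has lines.
--
-- Line count: double counting the triples (x, y, B) with x, y ∈ B in a
-- (v, k, 1)-design with b blocks gives b·k² + v = b·k + v² (the diagonal x = y
-- contributes b·k, every other ordered pair exactly 1).  For k = q ≥ 2 and
-- v = q² this forces b = q² + q.

open import Defs
open import Data.Nat using (ℕ; zero; suc; _+_; _*_; _≤_; z≤n; s≤s; NonZero)
open import Data.Nat.Properties
  using (+-*-semiring; +-comm; +-assoc; *-zeroʳ; *-identityʳ; +-cancelˡ-≡; +-cancelʳ-≡;
         *-cancelʳ-≡; m*n≢0; +-mono-≤; ≤-refl; ≤-trans; ≤-reflexive)
open import Data.Nat.Tactic.RingSolver using (solve-∀)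
open import Data.Bool using (Bool; true; false; _∧_; if_then_else_)
open import Data.Bool.Properties using (∧-idem)
open import Data.Fin using (Fin; splitAt; remainder; punchIn; _≟_) renaming (zero to fzero)
open import Data.Fin.Properties using (punchInᵢ≢i)
open import Data.Fin.Subset using (Subset; ∣_∣; ⊤)
open import Data.Fin.Subset.Properties using (∣⊤∣≡n; ∈⊤)
open import Data.Vec using ([]; _∷_; lookup; _++_; concat; replicate)
open import Data.Vec.Properties using (lookup-splitAt; []=⇒lookup)
open import Data.List using (List; []; _∷_; length; map)
open import Data.List.Properties using (length-map)
open import Data.List.Relation.Unary.All as All using (All; []; _∷_)
open import Data.List.Relation.Unary.All.Properties using (map⁺)
open import Data.Product using (_,_)
open import Data.Sum using (inj₁; inj₂)
open import Relation.Nullary using (yes; no)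
open import Relation.Binary.PropositionalEquality
open import Function using (_∘_)
open import Algebra.Properties.Semiring.Sum +-*-semiring
  using (sum; sum-syntax; sum-cong-≗; ∑-distrib-+; *-distribˡ-sum; *-distribʳ-sum; sum-remove)

open ≡-Reasoning

sum-const : ∀ n c → ∑[ i < n ] c ≡ n * c
sum-const zero    c = refl
sum-const (suc n) c = cong (c +_) (sum-const n c)

sum-zeros : ∀ n → ∑[ i < n ] 0 ≡ 0
sum-zeros n = trans (sum-const n 0) (*-zeroʳ n)

sum-all-but-one : ∀ {n} (f : Fin n → ℕ) x c → (∀ y → y ≢ x → f y ≡ c) →
  sum f + c ≡ f x + n * c
sum-all-but-one {suc n} f x c others = begin
  sum f + c                     ≡⟨ cong (_+ c) (sum-remove {i = x} f) ⟩
  f x + sum (f ∘ punchIn x) + c ≡⟨ cong (λ t → f x + t + c) rest ⟩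
  f x + n * c + c               ≡⟨ +-assoc (f x) (n * c) c ⟩
  f x + (n * c + c)             ≡⟨ cong (f x +_) (+-comm (n * c) c) ⟩
  f x + suc n * c               ∎
  where
  rest : sum (f ∘ punchIn x) ≡ n * c
  rest = trans (sum-cong-≗ (λ j → others (punchIn x j) (punchInᵢ≢i x j))) (sum-const n c)

indicator : Bool → ℕ
indicator b = if b then 1 else 0

indicator-∧ : ∀ a b → indicator (a ∧ b) ≡ indicator a * indicator b
indicator-∧ true  true  = refl
indicator-∧ true  false = refl
indicator-∧ false b     = refl

sum-membership : ∀ {n} (B : Subset n) → ∑[ x < n ] indicator (lookup B x) ≡ ∣ B ∣
sum-membership []          = refl
sum-membership (true ∷ B)  = cong suc (sum-membership B)
sum-membership (false ∷ B) = sum-membership B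

sum-pairs-in-block : ∀ {n} (B : Subset n) →
  ∑[ x < n ] ∑[ y < n ] indicator (lookup B x ∧ lookup B y) ≡ ∣ B ∣ * ∣ B ∣
sum-pairs-in-block {n} B = begin
  ∑[ x < n ] ∑[ y < n ] indicator (B′ x ∧ B′ y) ≡⟨ sum-cong-≗ factor ⟩
  ∑[ x < n ] (indicator (B′ x) * ∣ B ∣)        ≡⟨ sym (*-distribʳ-sum ∣ B ∣ (indicator ∘ B′)) ⟩
  (∑[ x < n ] indicator (B′ x)) * ∣ B ∣        ≡⟨ cong (_* ∣ B ∣) (sum-membership B) ⟩
  ∣ B ∣ * ∣ B ∣                                ∎
  where
  B′ : Fin n → Bool
  B′ = lookup B
  factor : ∀ x → ∑[ y < n ] indicator (B′ x ∧ B′ y) ≡ indicator (B′ x) * ∣ B ∣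
  factor x = begin
    ∑[ y < n ] indicator (B′ x ∧ B′ y)           ≡⟨ sum-cong-≗ (λ y → indicator-∧ (B′ x) (B′ y)) ⟩
    ∑[ y < n ] (indicator (B′ x) * indicator (B′ y)) ≡⟨ sym (*-distribˡ-sum (indicator (B′ x)) (indicator ∘ B′)) ⟩
    indicator (B′ x) * ∑[ y < n ] indicator (B′ y) ≡⟨ cong (indicator (B′ x) *_) (sum-membership B) ⟩
    indicator (B′ x) * ∣ B ∣                      ∎

sum-countPair : ∀ {v k} (Bs : List (Subset v)) → All (λ B → ∣ B ∣ ≡ k) Bs →
  ∑[ x < v ] ∑[ y < v ] countPair Bs x y ≡ length Bs * (k * k)
sum-countPair {v} [] [] = begin
  ∑[ x < v ] ∑[ y < v ] 0 ≡⟨ sum-cong-≗ {v} (λ _ → sum-zeros v) ⟩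
  ∑[ x < v ] 0            ≡⟨ sum-zeros v ⟩
  0                       ∎
sum-countPair {v} {k} (B ∷ Bs) (refl ∷ sizes) = begin
  ∑[ x < v ] ∑[ y < v ] (inB x y + countPair Bs x y)
    ≡⟨ sum-cong-≗ (λ x → ∑-distrib-+ (inB x) (countPair Bs x)) ⟩
  ∑[ x < v ] (∑[ y < v ] inB x y + ∑[ y < v ] countPair Bs x y)
    ≡⟨ ∑-distrib-+ (λ x → ∑[ y < v ] inB x y) (λ x → ∑[ y < v ] countPair Bs x y) ⟩
  ∑[ x < v ] ∑[ y < v ] inB x y + ∑[ x < v ] ∑[ y < v ] countPair Bs x y
    ≡⟨ cong₂ _+_ (sum-pairs-in-block B) (sum-countPair Bs sizes) ⟩
  k * k + length Bs * (k * k)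
    ∎
  where
  inB : Fin v → Fin v → ℕ
  inB x y = indicator (lookup B x ∧ lookup B y)

sum-countPair-diagonal : ∀ {v k} (Bs : List (Subset v)) → All (λ B → ∣ B ∣ ≡ k) Bs →
  ∑[ x < v ] countPair Bs x x ≡ length Bs * k
sum-countPair-diagonal {v} [] [] = sum-zeros v
sum-countPair-diagonal {v} (B ∷ Bs) (refl ∷ sizes) = begin
  ∑[ x < v ] (indicator (lookup B x ∧ lookup B x) + countPair Bs x x)
    ≡⟨ ∑-distrib-+ (λ x → indicator (lookup B x ∧ lookup B x)) (λ x → countPair Bs x x) ⟩
  ∑[ x < v ] indicator (lookup B x ∧ lookup B x) + ∑[ x < v ] countPair Bs x x
    ≡⟨ cong₂ _+_ (trans (sum-cong-≗ (λ x → cong indicator (∧-idem (lookup B x)))) (sum-membership B))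
                 (sum-countPair-diagonal Bs sizes) ⟩
  ∣ B ∣ + length Bs * ∣ B ∣
    ∎

-- Row x of the pair-count matrix has diagonal entry
-- countPair x x and v − 1 further entries equal to 1.
design-block-count : ∀ {v k} {Bs : List (Subset v)} → IsDesign v k 1 Bs →
  length Bs * (k * k) + v ≡ length Bs * k + v * v
design-block-count {v} {k} {Bs} (sizes , pairs) = begin
  length Bs * (k * k) + v
    ≡⟨ cong₂ _+_ (sym (sum-countPair Bs sizes)) (sym (trans (sum-const v 1) (*-identityʳ v))) ⟩
  ∑[ x < v ] ∑[ y < v ] countPair Bs x y + ∑[ x < v ] 1
    ≡⟨ sym (∑-distrib-+ (λ x → ∑[ y < v ] countPair Bs x y) (λ _ → 1)) ⟩
  ∑[ x < v ] (∑[ y < v ] countPair Bs x y + 1)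
    ≡⟨ sum-cong-≗ {v} row ⟩
  ∑[ x < v ] (countPair Bs x x + v)
    ≡⟨ ∑-distrib-+ (λ x → countPair Bs x x) (λ _ → v) ⟩
  ∑[ x < v ] countPair Bs x x + ∑[ x < v ] v
    ≡⟨ cong₂ _+_ (sum-countPair-diagonal Bs sizes) (sum-const v v) ⟩
  length Bs * k + v * v
    ∎
  where
  row : ∀ x → ∑[ y < v ] countPair Bs x y + 1 ≡ countPair Bs x x + v
  row x = trans (sum-all-but-one (countPair Bs x) x 1 (λ y y≢x → pairs x y (≢-sym y≢x)))
                (cong (countPair Bs x x +_) (*-identityʳ v))

affine-plane-line-count : ∀ m b .{{_ : NonZero m}} → let q = suc m in
  b * (q * q) + q * q ≡ b * q + q * q * (q * q) → b ≡ q * q + q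
affine-plane-line-count m b fisher =
  *-cancelʳ-≡ b (q * q + q) (q * m) {{m*n≢0 q m}} cancelled
  where
  q : ℕ
  q = suc m
  -- Subtracting b·q: b·q(q − 1) + q² = q⁴, and q⁴ = (q² + q)·q(q − 1) + q².
  cancelled : b * (q * m) ≡ (q * q + q) * (q * m)
  cancelled = +-cancelʳ-≡ (q * q) _ _ (+-cancelˡ-≡ (b * q) _ _ (begin
    b * q + (b * (q * m) + q * q)           ≡⟨ split-square b m ⟩
    b * (q * q) + q * q                     ≡⟨ fisher ⟩
    b * q + q * q * (q * q)                 ≡⟨ fourth-power b m ⟩
    b * q + ((q * q + q) * (q * m) + q * q) ∎))
    where
    split-square : ∀ b m → b * suc m + (b * (suc m * m) + suc m * suc m)
                         ≡ b * (suc m * suc m) + suc m * suc m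
    split-square = solve-∀
    fourth-power : ∀ b m → b * suc m + suc m * suc m * (suc m * suc m)
                         ≡ b * suc m + ((suc m * suc m + suc m) * (suc m * m) + suc m * suc m)
    fourth-power = solve-∀

countPair-≤-diagonal : ∀ {v} (Bs : List (Subset v)) x y → countPair Bs x y ≤ countPair Bs x x
countPair-≤-diagonal []       x y = z≤n
countPair-≤-diagonal (B ∷ Bs) x y =
  +-mono-≤ (pair≤single (lookup B x) (lookup B y)) (countPair-≤-diagonal Bs x y)
  where
  pair≤single : ∀ a b → indicator (a ∧ b) ≤ indicator (a ∧ a)
  pair≤single true  true  = ≤-refl
  pair≤single true  false = z≤n
  pair≤single false b     = z≤n

design⇒covering : ∀ {v k λ'} {Bs : List (Subset v)} → IsDesign v k λ' Bs → IsCovering v k λ' Bs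
design⇒covering (sizes , exact) = sizes , λ x y x≢y → ≤-reflexive (sym (exact x y x≢y))

-- In a λ-covering on at least two points every point lies in at least λ blocks
-- (those through it and some other point), so even pairs x = y are covered λ times.
covering-all-pairs : ∀ {m k λ'} {Bs : List (Subset (suc (suc m)))} →
  IsCovering (suc (suc m)) k λ' Bs → ∀ x y → λ' ≤ countPair Bs x y
covering-all-pairs {m} {Bs = Bs} (_ , covered) x y with x ≟ y
... | no x≢y  = covered x y x≢y
... | yes refl = ≤-trans (covered x other (≢-sym (punchInᵢ≢i x fzero)))
                         (countPair-≤-diagonal Bs x other)
  where
  other : Fin (suc (suc m))
  other = punchIn x fzero

-- Inflation: the point set Fin (s * n) consists of s copies of Fin n, the copy of
-- i lying over the point `remainder n i`; a block becomes the union of the copies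
-- of its points.
inflate : ∀ {n} s → Subset n → Subset (s * n)
inflate s B = concat (replicate s B)

lookup-inflate : ∀ {n} s (B : Subset n) i → lookup (inflate s B) i ≡ lookup B (remainder {s} n i)
lookup-inflate {n} (suc s) B i rewrite lookup-splitAt n B (inflate s B) i with splitAt n i
... | inj₁ j = refl
... | inj₂ j = lookup-inflate s B j

∣∣-++ : ∀ {m n} (A : Subset m) (B : Subset n) → ∣ A ++ B ∣ ≡ ∣ A ∣ + ∣ B ∣
∣∣-++ []          B = refl
∣∣-++ (true ∷ A)  B = cong suc (∣∣-++ A B)
∣∣-++ (false ∷ A) B = ∣∣-++ A B

∣inflate∣ : ∀ {n} s (B : Subset n) → ∣ inflate s B ∣ ≡ s * ∣ B ∣
∣inflate∣ zero    B = refl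
∣inflate∣ (suc s) B = trans (∣∣-++ B (inflate s B)) (cong (∣ B ∣ +_) (∣inflate∣ s B))

countPair-inflate : ∀ {n} s (Bs : List (Subset n)) i j →
  countPair (map (inflate s) Bs) i j ≡ countPair Bs (remainder {s} n i) (remainder {s} n j)
countPair-inflate s []       i j = refl
countPair-inflate s (B ∷ Bs) i j
  rewrite lookup-inflate s B i | lookup-inflate s B j = cong (_ +_) (countPair-inflate s Bs i j)

inflate-covering : ∀ {m k λ'} s {Bs : List (Subset (suc (suc m)))} →
  IsCovering (suc (suc m)) k λ' Bs →
  IsCovering (s * suc (suc m)) (s * k) λ' (map (inflate s) Bs)
inflate-covering s {Bs} covering@(sizes , _) =
  map⁺ (All.map (λ {B} ∣B∣≡k → trans (∣inflate∣ s B) (cong (s *_) ∣B∣≡k)) sizes) ,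
  λ i j _ → subst (_ ≤_) (sym (countPair-inflate s Bs i j)) (covering-all-pairs covering _ _)

whole-set-covering : ∀ n → IsCovering n n 1 (⊤ ∷ [])
whole-set-covering n = (∣⊤∣≡n n ∷ []) , λ x y _ → subst (1 ≤_) (sym (pair-in-⊤ x y)) ≤-refl
  where
  pair-in-⊤ : ∀ x y → countPair (⊤ ∷ []) x y ≡ 1
  pair-in-⊤ x y rewrite []=⇒lookup (∈⊤ {x = x}) | []=⇒lookup (∈⊤ {x = y}) = refl

-- Orders 0 and 1 are degenerate (no points, resp. one block covers everything);
-- for q ≥ 2 the inflated lines of the plane form the covering and there are
-- exactly q² + q of them.
lemma7p1 : (q s : ℕ) → AffinePlaneExists q → 1 ≤ s →
    CoveringNumber≤ 1 (s * (q * q)) (s * q) (q * q + q)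
lemma7p1 zero s _ _ rewrite *-zeroʳ s = [] , ([] , λ ()) , z≤n
lemma7p1 (suc zero) s _ _ = ⊤ ∷ [] , whole-set-covering (s * 1) , s≤s z≤n
lemma7p1 (suc (suc p)) s (lines , plane) _ =
  map (inflate s) lines ,
  inflate-covering s (design⇒covering plane) ,
  ≤-reflexive (trans (length-map (inflate s) lines)
                     (affine-plane-line-count (suc p) (length lines) (design-block-count plane)))
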